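{- Let $n_1,\ldots,n_k$ be positive integers. If $B(n_1,\ldots,n_k)$ is good, then $B(n_1,\ldots,n_k,n_{k+1})$ is good for every positive integer $n_{k+1}$.
   Context: For positive integers $m$, $[m]=\{1,\ldots,m\}$. For positive integers $n_1,\ldots,n_k$, the box is $B(n_1,\ldots,n_k) = [2n_1]\times\cdots\times[2n_k]$, and $\partial B(n_1,\ldots,n_k)$ is the set of $x \in B(n_1,\ldots,n_k)$ with $x_i \in \{1, 2n_i\}$ for some $i \in [k]$. For $x,y$ in the box, write $x \sim y$ if $x=y$ or $|x_i-y_i|=1$ for some $i$. A box $B(n_1,\ldots,n_k)$ is good if there is a subset $S \subseteq \partial B(n_1,\ldots,n_k)$ with $|S| = 2^k$ and $x\sim y$ for all $x,y\in S$. -}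

module Defs where

open import Data.Nat using (ℕ; suc; _*_; _^_; _≤_; _≡ᵇ_)
open import Data.Fin using (Fin; fromℕ)
open import Data.Product using (Σ; ∃; _×_)
open import Data.Sum using (_⊎_)
open import Data.List using (List; length)
open import Data.List.Relation.Unary.All using (All)
open import Data.List.Relation.Unary.AllPairs using (AllPairs)
open import Relation.Nullary using (¬_)
open import Data.Vec.Functional using (Vector; insertAt)
open import Relation.Binary.PropositionalEquality using (_≡_)

Point : ℕ → Set
Point k = Fin k → ℕ

InBox : ∀ {k} → (Fin k → ℕ) → Point k → Set
InBox n x = ∀ i → 1 ≤ x i × x i ≤ 2 * n i

InBoundary : ∀ {k} → (Fin k → ℕ) → Point k → Set
InBoundary n x = InBox n x × ∃ λ i → (x i ≡ 1 ⊎ x i ≡ 2 * n i)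

Adj1 : ℕ → ℕ → Set
Adj1 a b = suc a ≡ b ⊎ suc b ≡ a

_∼_ : ∀ {k} → Point k → Point k → Set
x ∼ y = (∀ i → x i ≡ y i) ⊎ ∃ λ i → Adj1 (x i) (y i)

_≢ₚ_ : ∀ {k} → Point k → Point k → Set
x ≢ₚ y = ¬ (∀ i → x i ≡ y i)

-- B(n) is good: there is a set S ⊆ ∂B(n) of exactly 2^k (distinct) points,
-- pairwise related by ∼.  S is represented by a duplicate-free list.
Good : ∀ {k} → (Fin k → ℕ) → Set
Good {k} n = Σ (List (Point k)) λ S →
  AllPairs _≢ₚ_ S × length S ≡ 2 ^ k × All (InBoundary n) S ×
  All (λ x → All (λ y → x ∼ y) S) S

extend : ∀ {k} → (Fin k → ℕ) → ℕ → (Fin (suc k) → ℕ)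
extend {k} n m = insertAt n (fromℕ k) m

{-# OPTIONS --safe #-}
module Submission where

-- Take a clique S ⊆ ∂B(n) of 2^k points and stack two copies of it in the adjacent
-- layers m and m + 1 of the new coordinate; both layers lie in [2m] because m ≥ 1.
-- A point stays on the boundary through the old coordinate that put it there, two
-- points of one layer are related (and distinct) exactly as in S, and two points of
-- different layers differ by 1 in the new coordinate.  This gives a clique of
-- 2^(k+1) points in ∂B(n, m).

open import Defs
open import Level using (Level; _⊔_)
open import Data.Nat using (ℕ; suc; _+_; _*_; _≤_; _<_; s≤s; z≤n)
open import Data.Nat.Properties using (+-identityʳ; ≤-trans; m≤m+n; m<m+n; <⇒≤; <⇒≢; n<1+n)
open import Data.Fin using (Fin; fromℕ; punchIn; punchOut; _≟_)
open import Data.Fin.Properties using (punchIn-punchOut)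
open import Data.Product using (_×_; _,_)
open import Data.Sum using (_⊎_; inj₁; inj₂)
open import Data.List using (List; length; map; _++_)
open import Data.List.Properties using (length-map; length-++)
open import Data.List.Relation.Unary.All as All using (All)
import Data.List.Relation.Unary.All.Properties as All
open import Data.List.Relation.Unary.AllPairs as AllPairs using (AllPairs)
import Data.List.Relation.Unary.AllPairs.Properties as AllPairs
open import Data.Vec.Functional using (insertAt)
open import Data.Vec.Functional.Properties using (insertAt-lookup; insertAt-punchIn)
open import Relation.Nullary using (yes; no)
open import Relation.Binary.PropositionalEquality using (_≡_; _≢_; refl; sym; cong; cong₂; subst; subst₂; trans; module ≡-Reasoning)

private
  variable
    a b ℓ ℓ′ : Level
    A : Set a
    B : Set b
    k : ℕ

Complete : {A : Set a} → (A → A → Set ℓ) → List A → Set (a ⊔ ℓ)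
Complete R xs = All (λ x → All (R x) xs) xs

module _ (f g : A → B) where

  length-map-++-map : ∀ xs → length (map f xs ++ map g xs) ≡ 2 * length xs
  length-map-++-map xs = begin
    length (map f xs ++ map g xs)          ≡⟨ length-++ (map f xs) ⟩
    length (map f xs) + length (map g xs)  ≡⟨ cong₂ _+_ (length-map f xs) (length-map g xs) ⟩
    length xs + length xs                  ≡⟨ cong (length xs +_) (sym (+-identityʳ _)) ⟩
    2 * length xs                          ∎
    where open ≡-Reasoning

  All-map-++-map : {P : A → Set ℓ} {P′ : B → Set ℓ′} →
                   (∀ {x} → P x → P′ (f x)) → (∀ {x} → P x → P′ (g x)) →
                   ∀ {xs} → All P xs → All P′ (map f xs ++ map g xs)
  All-map-++-map Pf Pg ps = All.++⁺ (All.map⁺ (All.map Pf ps)) (All.map⁺ (All.map Pg ps))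

  AllPairs-map-++-map : {Q : A → A → Set ℓ} {R : B → B → Set ℓ′} →
                        (∀ {x y} → Q x y → R (f x) (f y)) → (∀ {x y} → Q x y → R (g x) (g y)) →
                        (∀ x y → R (f x) (g y)) →
                        ∀ {xs} → AllPairs Q xs → AllPairs R (map f xs ++ map g xs)
  AllPairs-map-++-map Rff Rgg Rfg {xs} qs =
    AllPairs.++⁺ (AllPairs.map⁺ (AllPairs.map Rff qs)) (AllPairs.map⁺ (AllPairs.map Rgg qs))
                 (All.map⁺ (All.universal (λ x → All.map⁺ (All.universal (Rfg x) xs)) xs))

  Complete-map-++-map : {Q : A → A → Set ℓ} {R : B → B → Set ℓ′} →
                        (∀ {x y} → Q x y → R (f x) (f y)) → (∀ {x y} → Q x y → R (g x) (g y)) →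
                        (∀ x y → R (f x) (g y)) → (∀ x y → R (g x) (f y)) →
                        ∀ {xs} → Complete Q xs → Complete R (map f xs ++ map g xs)
  Complete-map-++-map Rff Rgg Rfg Rgf {xs} qs =
    All.++⁺ (All.map⁺ (All.map (λ {x} qx → All.++⁺ (All.map⁺ (All.map Rff qx))
                                                    (All.map⁺ (All.universal (Rfg x) xs))) qs))
            (All.map⁺ (All.map (λ {x} qx → All.++⁺ (All.map⁺ (All.universal (Rgf x) xs))
                                                    (All.map⁺ (All.map Rgg qx))) qs))

punchIn-elim : (p : Fin (suc k)) (P : Fin (suc k) → Set ℓ) →
               P p → (∀ i → P (punchIn p i)) → ∀ j → P j
punchIn-elim p P Pp Pin j with p ≟ j
... | yes refl = Pp
... | no p≢j   = subst P (punchIn-punchOut p≢j) (Pin (punchOut p≢j))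

insertAt-pointwise : (p : Fin (suc k)) (R : A → B → Set ℓ) {xs : Fin k → A} {ys : Fin k → B} {x : A} {y : B} →
                     (∀ i → R (xs i) (ys i)) → R x y → ∀ j → R (insertAt xs p x j) (insertAt ys p y j)
insertAt-pointwise p R {xs} {ys} {x} {y} Rxsys Rxy =
  punchIn-elim p (λ j → R (insertAt xs p x j) (insertAt ys p y j))
    (subst₂ R (sym (insertAt-lookup xs p x)) (sym (insertAt-lookup ys p y)) Rxy)
    (λ i → subst₂ R (sym (insertAt-punchIn xs p x i)) (sym (insertAt-punchIn ys p y i)) (Rxsys i))

module _ (p : Fin (suc k)) {x y : Point k} {a b : ℕ} where

  insertAt-≢ₚ : x ≢ₚ y → insertAt x p a ≢ₚ insertAt y p b
  insertAt-≢ₚ x≢y x≡y = x≢y λ i →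
    trans (sym (insertAt-punchIn x p a i)) (trans (x≡y (punchIn p i)) (insertAt-punchIn y p b i))

  insertAt-≢ₚ-pivot : a ≢ b → insertAt x p a ≢ₚ insertAt y p b
  insertAt-≢ₚ-pivot a≢b x≡y =
    a≢b (trans (sym (insertAt-lookup x p a)) (trans (x≡y p) (insertAt-lookup y p b)))

  insertAt-∼-pivot : Adj1 a b → insertAt x p a ∼ insertAt y p b
  insertAt-∼-pivot adj =
    inj₂ (p , subst₂ Adj1 (sym (insertAt-lookup x p a)) (sym (insertAt-lookup y p b)) adj)

insertAt-∼ : (p : Fin (suc k)) {x y : Point k} {a : ℕ} → x ∼ y → insertAt x p a ∼ insertAt y p a
insertAt-∼ p (inj₁ x≡y)       = inj₁ (insertAt-pointwise p _≡_ x≡y refl)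
insertAt-∼ p {x} {y} {a} (inj₂ (i , adj)) =
  inj₂ (punchIn p i , subst₂ Adj1 (sym (insertAt-punchIn x p a i)) (sym (insertAt-punchIn y p a i)) adj)

module _ (p : Fin (suc k)) {n x : Point k} {m a : ℕ} where

  insertAt-InBox : InBox n x → 1 ≤ a → a ≤ 2 * m → InBox (insertAt n p m) (insertAt x p a)
  insertAt-InBox box 1≤a a≤2m =
    insertAt-pointwise p (λ nᵢ xᵢ → 1 ≤ xᵢ × xᵢ ≤ 2 * nᵢ) box (1≤a , a≤2m)

  insertAt-InBoundary : InBoundary n x → 1 ≤ a → a ≤ 2 * m →
                        InBoundary (insertAt n p m) (insertAt x p a)
  insertAt-InBoundary (box , i , onFace) 1≤a a≤2m =
    insertAt-InBox box 1≤a a≤2m , punchIn p i , onFace′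
    where
    onFace′ : (insertAt x p a (punchIn p i) ≡ 1)
                ⊎ (insertAt x p a (punchIn p i) ≡ 2 * insertAt n p m (punchIn p i))
    onFace′ rewrite insertAt-punchIn x p a i | insertAt-punchIn n p m i = onFace

m<2*m : ∀ {m} → 1 ≤ m → m < 2 * m
m<2*m {m} 1≤m = m<m+n m (≤-trans 1≤m (m≤m+n m 0))

Good-insertAt : (p : Fin (suc k)) {n : Fin k → ℕ} {m : ℕ} → 1 ≤ m → Good n → Good (insertAt n p m)
Good-insertAt {k} p {m = m} 1≤m (S , distinct , size , boundary , related) =
    map lower S ++ map upper S
  , AllPairs-map-++-map lower upper (insertAt-≢ₚ p) (insertAt-≢ₚ p)
      (λ _ _ → insertAt-≢ₚ-pivot p (<⇒≢ (n<1+n m))) distinct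
  , trans (length-map-++-map lower upper S) (cong (2 *_) size)
  , All-map-++-map lower upper
      (λ x∈∂ → insertAt-InBoundary p x∈∂ 1≤m (<⇒≤ (m<2*m 1≤m)))
      (λ x∈∂ → insertAt-InBoundary p x∈∂ (s≤s z≤n) (m<2*m 1≤m)) boundary
  , Complete-map-++-map lower upper (insertAt-∼ p) (insertAt-∼ p)
      (λ _ _ → insertAt-∼-pivot p (inj₁ refl)) (λ _ _ → insertAt-∼-pivot p (inj₂ refl)) related
  where
  lower upper : Point k → Point (suc k)
  lower x = insertAt x p m
  upper x = insertAt x p (suc m)

proposition3p1 : (k : ℕ) (n : Fin k → ℕ) → (∀ i → 1 ≤ n i) →
    Good n → (m : ℕ) → 1 ≤ m → Good (extend n m)
proposition3p1 k n _ good m 1≤m = Good-insertAt (fromℕ k) 1≤m good
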